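{- Let $q$ be a power of an odd prime and let $0\le t<h\le n$ be integers. Then $$\sum_{k=0}^{h-t-1}\frac{(-1)^k(-q)^{ -\frac{k(k-1)}{2}}}{\big(1-(-q)^{ -(n-t-k)}\big)\prod_{l=1}^{h-t-k-1}(1-(-q)^{ -l})\prod_{l=1}^{k}(1-(-q)^{ -l})}=\frac{(-1)^{h-t-1}(-q)^{ -\frac{(h-t)(h-t-1)}{2}}(-q)^{ -(n-h)(h-t-1)}}{\prod_{l=n-h+1}^{n-t}(1-(-q)^{ -l})}.$$
   Context: Empty products equal $1$. -}

module Defs where

open import Data.Nat as ℕ using (ℕ; zero; suc; _∸_)
open import Data.Integer using (+_)
open import Data.Rational using (ℚ; 0ℚ; 1ℚ; _+_; _*_; -_; 1/_; _÷_; ≢-nonZero)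
open import Data.Rational.Properties using (_≟_)
open import Relation.Nullary using (yes; no)

ℕ→ℚ : ℕ → ℚ
ℕ→ℚ n = Data.Rational._/_ (+ n) 1

_^ℚ_ : ℚ → ℕ → ℚ
x ^ℚ zero = 1ℚ
x ^ℚ suc n = x * (x ^ℚ n)

-- total field inverse (inv 0 = 0); only applied to nonzero values below
inv : ℚ → ℚ
inv p with p ≟ 0ℚ
... | yes _ = 0ℚ
... | no p≢0 = 1/_ p {{≢-nonZero p≢0}}

_÷ℚ_ : ℚ → ℚ → ℚ
a ÷ℚ b = a * inv b

-- sum_{k=a}^{b} f k  (empty, i.e. 0, if b < a)
sumFromTo : ℕ → ℕ → (ℕ → ℚ) → ℚ
sumFromTo a b f = go (suc b ∸ a)
  where
  go : ℕ → ℚ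
  go zero = 0ℚ
  go (suc m) = go m + f (a ℕ.+ m)

-- prod_{l=a}^{b} f l  (empty, i.e. 1, if b < a)
prodFromTo : ℕ → ℕ → (ℕ → ℚ) → ℚ
prodFromTo a b f = go (suc b ∸ a)
  where
  go : ℕ → ℚ
  go zero = 1ℚ
  go (suc m) = go m * f (a ℕ.+ m)

negqInvPow : ℕ → ℕ → ℚ
negqInvPow q m = inv ((- ℕ→ℚ q) ^ℚ m)

sgn : ℕ → ℚ
sgn k = (- 1ℚ) ^ℚ k

{-# OPTIONS --safe #-}
-- Put x = (-q)⁻¹, r = h-t-1, s = n-h and N = n-t = r+s+1. The k-th summand is T(r,k) / (1 - x^(N-k))
-- with T(r,k) = (-1)^k x^(k(k-1)/2) / ((x;x)_(r-k) (x;x)_k), and Σₖ T(r+1,k) = 0 by the q-binomial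
-- theorem. Splitting 1 - x^(s+1) = (1 - x^(N-k)) - x^(s+1) (1 - x^(r+1-k)) inside each summand shows that
-- the left-hand side F(r,s) satisfies (1 - x^(s+1)) F(r+1,s) = -x^(s+1) F(r,s+1). The right-hand side
-- obeys the same recursion and both sides equal 1/(1 - x^(s+1)) at r = 0, so induction on r concludes.
module Submission where

open import Defs
open import Data.Nat using (ℕ; _≤_; _<_; _∸_; _/_; _%_) renaming (_*_ to _*ℕ_; _+_ to _+ℕ_; _^_ to _^ℕ_)
open import Data.Nat.Primality using (Prime)
open import Data.Rational using (ℚ; 1ℚ; _-_; _*_)
open import Relation.Binary.PropositionalEquality using (_≡_)

open import Data.Nat using (zero; suc; z≤n; s≤s)
import Data.Nat.Properties as ℕ
open import Data.Nat.DivMod using (m*n/n≡m)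
open import Data.Nat.Primality using (¬prime[1])
open import Data.Nat.Coprimality using (1-coprimeTo) renaming (sym to coprime-sym)
open import Data.Nat.Tactic.RingSolver using () renaming (solve-∀ to ℕ-solve-∀)
open import Data.Integer using (+_)
import Data.Integer.Properties as ℤ
open import Data.Rational using (0ℚ; _+_; -_; mkℚ; ↥_; ≢-nonZero)
open import Data.Rational.Properties
  using (_≟_; +-*-commutativeRing; +-0-commutativeMonoid; *-1-commutativeMonoid; normalize-coprime;
         *-inverseʳ; *-assoc; *-comm; *-identityˡ; *-identityʳ;
         *-zeroˡ; *-zeroʳ; +-identityˡ; +-identityʳ; +-assoc; *-distribˡ-+)
open import Data.Sum using (inj₁; inj₂)
open import Function using (_∘_)
open import Relation.Nullary using (Dec; yes; no; contradiction)
open import Relation.Nullary.Decidable.Core using (dec⇒maybe)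
open import Relation.Binary.PropositionalEquality
  using (_≢_; refl; sym; trans; cong; cong₂; subst; module ≡-Reasoning)
open import Tactic.RingSolver using (solve-∀)
open import Tactic.RingSolver.Core.AlmostCommutativeRing using (AlmostCommutativeRing; fromCommutativeRing)
open import Level using (0ℓ)
open import Algebra.Bundles using (CommutativeMonoid)
open import Algebra.Properties.CommutativeSemigroup (CommutativeMonoid.commutativeSemigroup +-0-commutativeMonoid)
  using () renaming (interchange to +-interchange)
open import Algebra.Properties.CommutativeSemigroup (CommutativeMonoid.commutativeSemigroup *-1-commutativeMonoid)
  using () renaming (interchange to *-interchange)

open ≡-Reasoning

ℚ-ring : AlmostCommutativeRing 0ℓ 0ℓ
ℚ-ring = fromCommutativeRing +-*-commutativeRing (λ p → dec⇒maybe (0ℚ ≟ p))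

inv-inverseʳ : ∀ {p} → p ≢ 0ℚ → p * inv p ≡ 1ℚ
inv-inverseʳ {p} p≢0 with p ≟ 0ℚ
... | yes p≡0 = contradiction p≡0 p≢0
... | no  p≢0′ = *-inverseʳ p {{≢-nonZero p≢0′}}

inv-*-cancelˡ : ∀ {p q} → p ≢ 0ℚ → inv p * (p * q) ≡ q
inv-*-cancelˡ {p} {q} p≢0 = begin
  inv p * (p * q)  ≡⟨ sym (*-assoc (inv p) p q) ⟩
  inv p * p * q    ≡⟨ cong (_* q) (trans (*-comm (inv p) p) (inv-inverseʳ p≢0)) ⟩
  1ℚ * q           ≡⟨ *-identityˡ q ⟩
  q                ∎

*-cancelˡ-≢0 : ∀ {p q r} → p ≢ 0ℚ → p * q ≡ p * r → q ≡ r
*-cancelˡ-≢0 {p} p≢0 pq≡pr =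
  trans (sym (inv-*-cancelˡ p≢0)) (trans (cong (inv p *_) pq≡pr) (inv-*-cancelˡ p≢0))

inv-unique : ∀ p {u} → p * u ≡ 1ℚ → inv p ≡ u
inv-unique p {u} pu≡1 = begin
  inv p            ≡⟨ sym (*-identityʳ (inv p)) ⟩
  inv p * 1ℚ       ≡⟨ cong (inv p *_) (sym pu≡1) ⟩
  inv p * (p * u)  ≡⟨ inv-*-cancelˡ p≢0 ⟩
  u                ∎
  where
  p≢0 : p ≢ 0ℚ
  p≢0 refl = contradiction (trans (sym pu≡1) (*-zeroˡ u)) λ ()

inv-* : ∀ p q → inv (p * q) ≡ inv p * inv q
inv-* p q = by-cases (p ≟ 0ℚ) (q ≟ 0ℚ)
  where
  by-cases : Dec (p ≡ 0ℚ) → Dec (q ≡ 0ℚ) → inv (p * q) ≡ inv p * inv q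
  by-cases (yes refl) _ = trans (cong inv (*-zeroˡ q)) (sym (*-zeroˡ (inv q)))
  by-cases (no _) (yes refl) = trans (cong inv (*-zeroʳ p)) (sym (*-zeroʳ (inv p)))
  by-cases (no p≢0) (no q≢0) = inv-unique (p * q) (begin
    p * q * (inv p * inv q)    ≡⟨ *-interchange p q (inv p) (inv q) ⟩
    p * inv p * (q * inv q)    ≡⟨ cong₂ _*_ (inv-inverseʳ p≢0) (inv-inverseʳ q≢0) ⟩
    1ℚ                         ∎)

inv-involutive : ∀ p → inv (inv p) ≡ p
inv-involutive p = by-cases (p ≟ 0ℚ)
  where
  by-cases : Dec (p ≡ 0ℚ) → inv (inv p) ≡ p
  by-cases (yes refl) = refl
  by-cases (no p≢0) = inv-unique (inv p) (trans (*-comm (inv p) p) (inv-inverseʳ p≢0))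

*-inv-cancelˡ : ∀ {p q} → p ≢ 0ℚ → p * inv (p * q) ≡ inv q
*-inv-cancelˡ {p} {q} p≢0 = begin
  p * inv (p * q)        ≡⟨ cong (p *_) (inv-* p q) ⟩
  p * (inv p * inv q)    ≡⟨ sym (*-assoc p (inv p) (inv q)) ⟩
  p * inv p * inv q      ≡⟨ cong (_* inv q) (inv-inverseʳ p≢0) ⟩
  1ℚ * inv q             ≡⟨ *-identityˡ (inv q) ⟩
  inv q                  ∎

1-p≢0 : ∀ {p} → p ≢ 1ℚ → 1ℚ - p ≢ 0ℚ
1-p≢0 {p} p≢1 1-p≡0 = p≢1 (begin
  p                ≡⟨ double-neg p ⟩
  1ℚ - (1ℚ - p)    ≡⟨ cong (λ z → 1ℚ - z) 1-p≡0 ⟩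
  1ℚ               ∎)
  where
  double-neg : ∀ a → a ≡ 1ℚ - (1ℚ - a)
  double-neg = solve-∀ ℚ-ring

^ℚ-+ : ∀ p m n → p ^ℚ (m +ℕ n) ≡ p ^ℚ m * p ^ℚ n
^ℚ-+ p zero    n = sym (*-identityˡ (p ^ℚ n))
^ℚ-+ p (suc m) n = trans (cong (p *_) (^ℚ-+ p m n)) (sym (*-assoc p (p ^ℚ m) (p ^ℚ n)))

^ℚ-distribʳ-* : ∀ p q n → (p * q) ^ℚ n ≡ p ^ℚ n * q ^ℚ n
^ℚ-distribʳ-* p q zero    = refl
^ℚ-distribʳ-* p q (suc n) = begin
  p * q * (p * q) ^ℚ n           ≡⟨ cong (p * q *_) (^ℚ-distribʳ-* p q n) ⟩
  p * q * (p ^ℚ n * q ^ℚ n)      ≡⟨ *-interchange p q (p ^ℚ n) (q ^ℚ n) ⟩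
  p * p ^ℚ n * (q * q ^ℚ n)      ∎

tri : ℕ → ℕ
tri zero    = 0
tri (suc k) = k +ℕ tri k

tri-suc-*2 : ∀ k → tri (suc k) *ℕ 2 ≡ suc k *ℕ k
tri-suc-*2 zero    = refl
tri-suc-*2 (suc k) = begin
  (suc k +ℕ tri (suc k)) *ℕ 2        ≡⟨ ℕ.*-distribʳ-+ 2 (suc k) (tri (suc k)) ⟩
  suc k *ℕ 2 +ℕ tri (suc k) *ℕ 2     ≡⟨ cong (suc k *ℕ 2 +ℕ_) (tri-suc-*2 k) ⟩
  suc k *ℕ 2 +ℕ suc k *ℕ k           ≡⟨ sym (ℕ.*-distribˡ-+ (suc k) 2 k) ⟩
  suc k *ℕ suc (suc k)               ≡⟨ ℕ.*-comm (suc k) (suc (suc k)) ⟩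
  suc (suc k) *ℕ suc k               ∎

k*[k∸1]/2≡tri : ∀ k → (k *ℕ (k ∸ 1)) / 2 ≡ tri k
k*[k∸1]/2≡tri zero    = refl
k*[k∸1]/2≡tri (suc k) = trans (cong (_/ 2) (sym (tri-suc-*2 k))) (m*n/n≡m (tri (suc k)) 2)

∸-∸-comm : ∀ m n o → m ∸ n ∸ o ≡ m ∸ o ∸ n
∸-∸-comm m n o = begin
  m ∸ n ∸ o      ≡⟨ ℕ.∸-+-assoc m n o ⟩
  m ∸ (n +ℕ o)   ≡⟨ cong (m ∸_) (ℕ.+-comm n o) ⟩
  m ∸ (o +ℕ n)   ≡⟨ sym (ℕ.∸-+-assoc m o n) ⟩
  m ∸ o ∸ n      ∎

m<n⇒n∸m≡1+[n∸m∸1] : ∀ {m n} → m < n → n ∸ m ≡ suc (n ∸ m ∸ 1)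
m<n⇒n∸m≡1+[n∸m∸1] {zero}  (s≤s _)   = refl
m<n⇒n∸m≡1+[n∸m∸1] {suc m} (s≤s m<n) = m<n⇒n∸m≡1+[n∸m∸1] m<n

[n∸m]+[o∸n]≡o∸m : ∀ {m n o} → m ≤ n → n ≤ o → (n ∸ m) +ℕ (o ∸ n) ≡ o ∸ m
[n∸m]+[o∸n]≡o∸m z≤n       n≤o       = ℕ.m+[n∸m]≡n n≤o
[n∸m]+[o∸n]≡o∸m (s≤s m≤n) (s≤s n≤o) = [n∸m]+[o∸n]≡o∸m m≤n n≤o

sum-cong : ∀ r {f g : ℕ → ℚ} → (∀ {k} → k ≤ r → f k ≡ g k) → sumFromTo 0 r f ≡ sumFromTo 0 r g
sum-cong zero    f≗g = cong (λ z → 0ℚ + z) (f≗g z≤n)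
sum-cong (suc r) f≗g = cong₂ _+_ (sum-cong r (f≗g ∘ ℕ.m≤n⇒m≤1+n)) (f≗g ℕ.≤-refl)

sum-+ : ∀ r (f g : ℕ → ℚ) → sumFromTo 0 r (λ k → f k + g k) ≡ sumFromTo 0 r f + sumFromTo 0 r g
sum-+ zero    f g = trans (+-identityˡ _) (sym (cong₂ _+_ (+-identityˡ (f 0)) (+-identityˡ (g 0))))
sum-+ (suc r) f g = begin
  sumFromTo 0 r (λ k → f k + g k) + (f (suc r) + g (suc r))
    ≡⟨ cong (_+ (f (suc r) + g (suc r))) (sum-+ r f g) ⟩
  sumFromTo 0 r f + sumFromTo 0 r g + (f (suc r) + g (suc r))
    ≡⟨ +-interchange (sumFromTo 0 r f) (sumFromTo 0 r g) (f (suc r)) (g (suc r)) ⟩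
  sumFromTo 0 r f + f (suc r) + (sumFromTo 0 r g + g (suc r)) ∎

sum-*ˡ : ∀ r c (f : ℕ → ℚ) → sumFromTo 0 r (λ k → c * f k) ≡ c * sumFromTo 0 r f
sum-*ˡ zero    c f = distrib c (f 0)
  where
  distrib : ∀ c a → 0ℚ + c * a ≡ c * (0ℚ + a)
  distrib = solve-∀ ℚ-ring
sum-*ˡ (suc r) c f = begin
  sumFromTo 0 r (λ k → c * f k) + c * f (suc r)   ≡⟨ cong (_+ c * f (suc r)) (sum-*ˡ r c f) ⟩
  c * sumFromTo 0 r f + c * f (suc r)             ≡⟨ sym (*-distribˡ-+ c (sumFromTo 0 r f) (f (suc r))) ⟩
  c * (sumFromTo 0 r f + f (suc r))               ∎

sum-suc : ∀ r (f : ℕ → ℚ) → sumFromTo 0 (suc r) f ≡ f 0 + sumFromTo 0 r (f ∘ suc)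
sum-suc zero    f = shuffle (f 0) (f 1)
  where
  shuffle : ∀ a b → 0ℚ + a + b ≡ a + (0ℚ + b)
  shuffle = solve-∀ ℚ-ring
sum-suc (suc r) f = begin
  sumFromTo 0 (suc r) f + f (suc (suc r))                   ≡⟨ cong (_+ f (suc (suc r))) (sum-suc r f) ⟩
  f 0 + sumFromTo 0 r (f ∘ suc) + f (suc (suc r))           ≡⟨ +-assoc (f 0) _ _ ⟩
  f 0 + (sumFromTo 0 r (f ∘ suc) + f (suc (suc r)))         ∎

prodFromTo-empty : ∀ a (f : ℕ → ℚ) → prodFromTo (suc a) a f ≡ 1ℚ
prodFromTo-empty a f with a ∸ a | ℕ.n∸n≡0 a
... | _ | refl = refl

prodFromTo-snoc : ∀ {a b} (f : ℕ → ℚ) → a ≤ suc b → prodFromTo a (suc b) f ≡ prodFromTo a b f * f (suc b)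
prodFromTo-snoc {a} {b} f a≤1+b with suc (suc b) ∸ a | ℕ.+-∸-assoc 1 a≤1+b
... | _ | refl = cong (λ i → prodFromTo a b f * f i) (ℕ.m+[n∸m]≡n a≤1+b)

prodFromTo-singleton : ∀ a (f : ℕ → ℚ) → prodFromTo a a f ≡ f a
prodFromTo-singleton zero    f = *-identityˡ (f 0)
prodFromTo-singleton (suc a) f = begin
  prodFromTo (suc a) (suc a) f        ≡⟨ prodFromTo-snoc {b = a} f ℕ.≤-refl ⟩
  prodFromTo (suc a) a f * f (suc a)  ≡⟨ cong (_* f (suc a)) (prodFromTo-empty a f) ⟩
  1ℚ * f (suc a)                      ≡⟨ *-identityˡ (f (suc a)) ⟩
  f (suc a)                           ∎

prodFromTo-cons : ∀ {a b} (f : ℕ → ℚ) → a ≤ b → prodFromTo a b f ≡ f a * prodFromTo (suc a) b f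
prodFromTo-cons {a} {b} f a≤b with ℕ.m≤n⇒m<n∨m≡n a≤b
prodFromTo-cons {a} {_} f _ | inj₂ refl = begin
  prodFromTo a a f                    ≡⟨ prodFromTo-singleton a f ⟩
  f a                                 ≡⟨ sym (*-identityʳ (f a)) ⟩
  f a * 1ℚ                            ≡⟨ cong (f a *_) (sym (prodFromTo-empty a f)) ⟩
  f a * prodFromTo (suc a) a f        ∎
prodFromTo-cons {a} {suc b} f _ | inj₁ (s≤s a≤b) = begin
  prodFromTo a (suc b) f                          ≡⟨ prodFromTo-snoc f (ℕ.m≤n⇒m≤1+n a≤b) ⟩
  prodFromTo a b f * f (suc b)                    ≡⟨ cong (_* f (suc b)) (prodFromTo-cons f a≤b) ⟩
  f a * prodFromTo (suc a) b f * f (suc b)        ≡⟨ *-assoc (f a) _ (f (suc b)) ⟩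
  f a * (prodFromTo (suc a) b f * f (suc b))      ≡⟨ cong (f a *_) (sym (prodFromTo-snoc f (s≤s a≤b))) ⟩
  f a * prodFromTo (suc a) (suc b) f              ∎

-- w l stands for x ^ l, so that P l = 1 − x^l and poch j = (x;x)_j. Keeping the power map abstract
-- lets it be instantiated by negqInvPow q without rewriting under the binders of the statement.
module _ (w : ℕ → ℚ) (w-0 : w 0 ≡ 1ℚ) (w-+ : ∀ m n → w (m +ℕ n) ≡ w m * w n)
         (w-suc≢1 : ∀ l → w (suc l) ≢ 1ℚ) where

  P : ℕ → ℚ
  P l = 1ℚ - w l

  poch : ℕ → ℚ
  poch j = prodFromTo 1 j P

  P-0 : P 0 ≡ 0ℚ
  P-0 = cong (λ z → 1ℚ - z) w-0

  P-suc≢0 : ∀ l → P (suc l) ≢ 0ℚ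
  P-suc≢0 l = 1-p≢0 (w-suc≢1 l)

  w-∸ : ∀ {k m} → k ≤ m → w m ≡ w (m ∸ k) * w k
  w-∸ {k} {m} k≤m = trans (cong w (sym (ℕ.m∸n+n≡m k≤m))) (w-+ (m ∸ k) k)

  P-suc*inv-poch-suc : ∀ j → P (suc j) * inv (poch (suc j)) ≡ inv (poch j)
  P-suc*inv-poch-suc j =
    trans (cong (λ π → P (suc j) * inv π) (*-comm (poch j) (P (suc j)))) (*-inv-cancelˡ (P-suc≢0 j))

  term : ℕ → ℕ → ℚ
  term r k = sgn k * w (tri k) * inv (poch (r ∸ k)) * inv (poch k)

  term-suc-≤ : ∀ {r k} → k ≤ r → P (suc r ∸ k) * term (suc r) k ≡ term r k
  term-suc-≤ {r} {k} k≤r = begin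
    P (suc r ∸ k) * (c * inv (poch (suc r ∸ k)) * i)
      ≡⟨ cong (λ m → P m * (c * inv (poch m) * i)) (ℕ.+-∸-assoc 1 k≤r) ⟩
    P (suc j) * (c * inv (poch (suc j)) * i)
      ≡⟨ regroup (P (suc j)) c (inv (poch (suc j))) i ⟩
    c * (P (suc j) * inv (poch (suc j))) * i
      ≡⟨ cong (λ z → c * z * i) (P-suc*inv-poch-suc j) ⟩
    c * inv (poch j) * i ∎
    where
    j = r ∸ k
    c = sgn k * w (tri k)
    i = inv (poch k)
    regroup : ∀ p c a i → p * (c * a * i) ≡ c * (p * a) * i
    regroup = solve-∀ ℚ-ring

  term-suc-suc : ∀ r k → P (suc k) * term (suc r) (suc k) ≡ - (w k * term r k)
  term-suc-suc r k = begin
    P (suc k) * (- 1ℚ * σ * w (k +ℕ tri k) * a * inv (poch (suc k)))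
      ≡⟨ cong (λ z → P (suc k) * (- 1ℚ * σ * z * a * inv (poch (suc k)))) (w-+ k (tri k)) ⟩
    P (suc k) * (- 1ℚ * σ * (w k * w (tri k)) * a * inv (poch (suc k)))
      ≡⟨ regroup (P (suc k)) σ (w k) (w (tri k)) a (inv (poch (suc k))) ⟩
    - (w k * (σ * w (tri k) * a * (P (suc k) * inv (poch (suc k)))))
      ≡⟨ cong (λ z → - (w k * (σ * w (tri k) * a * z))) (P-suc*inv-poch-suc k) ⟩
    - (w k * term r k) ∎
    where
    σ = sgn k
    a = inv (poch (r ∸ k))
    regroup : ∀ p σ x y a i → p * (- 1ℚ * σ * (x * y) * a * i) ≡ - (x * (σ * y * a * (p * i)))
    regroup = solve-∀ ℚ-ring

  sum-term-suc-≤ : ∀ r (g : ℕ → ℚ) →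
    sumFromTo 0 (suc r) (λ k → P (suc r ∸ k) * term (suc r) k * g k) ≡ sumFromTo 0 r (λ k → term r k * g k)
  sum-term-suc-≤ r g = begin
    sumFromTo 0 r (λ k → P (suc r ∸ k) * term (suc r) k * g k) + P (r ∸ r) * term (suc r) (suc r) * g (suc r)
      ≡⟨ cong₂ _+_ (sum-cong r (λ k≤r → cong (_* g _) (term-suc-≤ k≤r))) top≡0 ⟩
    sumFromTo 0 r (λ k → term r k * g k) + 0ℚ
      ≡⟨ +-identityʳ _ ⟩
    sumFromTo 0 r (λ k → term r k * g k) ∎
    where
    top≡0 : P (r ∸ r) * term (suc r) (suc r) * g (suc r) ≡ 0ℚ
    top≡0 = begin
      P (r ∸ r) * t * g (suc r)  ≡⟨ cong (λ m → P m * t * g (suc r)) (ℕ.n∸n≡0 r) ⟩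
      P 0 * t * g (suc r)        ≡⟨ cong (λ z → z * t * g (suc r)) P-0 ⟩
      0ℚ * t * g (suc r)         ≡⟨ cong (_* g (suc r)) (*-zeroˡ t) ⟩
      0ℚ * g (suc r)             ≡⟨ *-zeroˡ (g (suc r)) ⟩
      0ℚ                         ∎
      where
      t = term (suc r) (suc r)

  termSum : ℕ → ℚ
  termSum r = sumFromTo 0 r (term r)

  sum-term-suc-suc : ∀ r → sumFromTo 0 (suc r) (λ k → w (suc r ∸ k) * (P k * term (suc r) k)) ≡ - w r * termSum r
  sum-term-suc-suc r = begin
    sumFromTo 0 (suc r) B                          ≡⟨ sum-suc r B ⟩
    B 0 + sumFromTo 0 r (B ∘ suc)                  ≡⟨ cong₂ _+_ B-0 (sum-cong r B-suc) ⟩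
    0ℚ + sumFromTo 0 r (λ k → - w r * term r k)    ≡⟨ +-identityˡ _ ⟩
    sumFromTo 0 r (λ k → - w r * term r k)         ≡⟨ sum-*ˡ r (- w r) (term r) ⟩
    - w r * termSum r                              ∎
    where
    B : ℕ → ℚ
    B k = w (suc r ∸ k) * (P k * term (suc r) k)

    neg-assoc : ∀ a b t → a * - (b * t) ≡ - (a * b) * t
    neg-assoc = solve-∀ ℚ-ring

    B-0 : B 0 ≡ 0ℚ
    B-0 = begin
      w (suc r) * (P 0 * term (suc r) 0)  ≡⟨ cong (λ z → w (suc r) * (z * term (suc r) 0)) P-0 ⟩
      w (suc r) * (0ℚ * term (suc r) 0)   ≡⟨ cong (w (suc r) *_) (*-zeroˡ (term (suc r) 0)) ⟩
      w (suc r) * 0ℚ                      ≡⟨ *-zeroʳ (w (suc r)) ⟩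
      0ℚ                                  ∎

    B-suc : ∀ {k} → k ≤ r → B (suc k) ≡ - w r * term r k
    B-suc {k} k≤r = begin
      w (r ∸ k) * (P (suc k) * term (suc r) (suc k))  ≡⟨ cong (w (r ∸ k) *_) (term-suc-suc r k) ⟩
      w (r ∸ k) * - (w k * term r k)                  ≡⟨ neg-assoc (w (r ∸ k)) (w k) (term r k) ⟩
      - (w (r ∸ k) * w k) * term r k                  ≡⟨ cong (λ z → - z * term r k) (sym (w-∸ k≤r)) ⟩
      - w r * term r k                                ∎

  -- Split 1 − x^(r+1) = (1 − x^(r+1−k)) + x^(r+1−k) (1 − x^k) in the k-th term.
  termSum-rec : ∀ r → P (suc r) * termSum (suc r) ≡ P r * termSum r
  termSum-rec r = begin
    P (suc r) * termSum (suc r)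
      ≡⟨ sym (sum-*ˡ (suc r) (P (suc r)) (term (suc r))) ⟩
    sumFromTo 0 (suc r) (λ k → P (suc r) * term (suc r) k)
      ≡⟨ sum-cong (suc r) split ⟩
    sumFromTo 0 (suc r) (λ k → A k + B k)
      ≡⟨ sum-+ (suc r) A B ⟩
    sumFromTo 0 (suc r) A + sumFromTo 0 (suc r) B
      ≡⟨ cong₂ _+_ lower (sum-term-suc-suc r) ⟩
    termSum r + - w r * termSum r
      ≡⟨ factor (w r) (termSum r) ⟩
    P r * termSum r ∎
    where
    A B : ℕ → ℚ
    A k = P (suc r ∸ k) * term (suc r) k * 1ℚ
    B k = w (suc r ∸ k) * (P k * term (suc r) k)

    expand : ∀ a b t → (1ℚ - a * b) * t ≡ (1ℚ - a) * t * 1ℚ + a * ((1ℚ - b) * t)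
    expand = solve-∀ ℚ-ring
    factor : ∀ x s → s + - x * s ≡ (1ℚ - x) * s
    factor = solve-∀ ℚ-ring

    split : ∀ {k} → k ≤ suc r → P (suc r) * term (suc r) k ≡ A k + B k
    split {k} k≤1+r = trans (cong (λ z → (1ℚ - z) * term (suc r) k) (w-∸ k≤1+r))
                            (expand (w (suc r ∸ k)) (w k) (term (suc r) k))

    lower : sumFromTo 0 (suc r) A ≡ termSum r
    lower = trans (sum-term-suc-≤ r (λ _ → 1ℚ)) (sum-cong r (λ _ → *-identityʳ _))

  termSum-suc≡0 : ∀ r → termSum (suc r) ≡ 0ℚ
  termSum-suc≡0 r = *-cancelˡ-≢0 (P-suc≢0 r) (begin
    P (suc r) * termSum (suc r)  ≡⟨ termSum-rec r ⟩
    P r * termSum r              ≡⟨ previous r ⟩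
    0ℚ                           ≡⟨ sym (*-zeroʳ (P (suc r))) ⟩
    P (suc r) * 0ℚ               ∎)
    where
    previous : ∀ r → P r * termSum r ≡ 0ℚ
    previous zero    = trans (cong (_* termSum 0) P-0) (*-zeroˡ (termSum 0))
    previous (suc r) = trans (cong (P (suc r) *_) (termSum-suc≡0 r)) (*-zeroʳ (P (suc r)))

  fractionSum : ℕ → ℕ → ℚ
  fractionSum N r = sumFromTo 0 r (λ k → term r k * inv (P (N ∸ k)))

  closedForm : ℕ → ℕ → ℕ → ℚ
  closedForm s r N = sgn r * w (tri (suc r)) * w (s *ℕ r) * inv (prodFromTo (suc s) N P)

  P-suc*fraction : ∀ m s t →
    P (suc s) * (t * inv (P (m +ℕ suc s))) ≡ t + - w (suc s) * (P m * t * inv (P (m +ℕ suc s)))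
  P-suc*fraction m s t = begin
    P (suc s) * (t * inv D)                     ≡⟨ expand (w (suc s)) (w m) t (inv D) ⟩
    t * ((1ℚ - w m * w (suc s)) * inv D) + c    ≡⟨ cong (λ z → t * ((1ℚ - z) * inv D) + c) (sym (w-+ m (suc s))) ⟩
    t * (D * inv D) + c                         ≡⟨ cong (λ z → t * z + c) (inv-inverseʳ D≢0) ⟩
    t * 1ℚ + c                                  ≡⟨ cong (_+ c) (*-identityʳ t) ⟩
    t + c                                       ∎
    where
    D = P (m +ℕ suc s)
    c = - w (suc s) * (P m * t * inv D)
    D≢0 : D ≢ 0ℚ
    D≢0 = subst (λ l → P l ≢ 0ℚ) (sym (ℕ.+-suc m s)) (P-suc≢0 (m +ℕ s))
    expand : ∀ a b t i → (1ℚ - a) * (t * i) ≡ t * ((1ℚ - b * a) * i) + - a * ((1ℚ - b) * t * i)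
    expand = solve-∀ ℚ-ring

  fractionSum-rec : ∀ s r → P (suc s) * fractionSum (suc r +ℕ suc s) (suc r)
                            ≡ - (w (suc s) * fractionSum (suc r +ℕ suc s) r)
  fractionSum-rec s r = begin
    P (suc s) * fractionSum N (suc r)
      ≡⟨ sym (sum-*ˡ (suc r) (P (suc s)) _) ⟩
    sumFromTo 0 (suc r) (λ k → P (suc s) * (term (suc r) k * inv (P (N ∸ k))))
      ≡⟨ sum-cong (suc r) split ⟩
    sumFromTo 0 (suc r) (λ k → term (suc r) k + - w (suc s) * C k)
      ≡⟨ sum-+ (suc r) (term (suc r)) _ ⟩
    termSum (suc r) + sumFromTo 0 (suc r) (λ k → - w (suc s) * C k)
      ≡⟨ cong₂ _+_ (termSum-suc≡0 r) (sum-*ˡ (suc r) (- w (suc s)) C) ⟩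
    0ℚ + - w (suc s) * sumFromTo 0 (suc r) C
      ≡⟨ cong (λ z → 0ℚ + - w (suc s) * z) (sum-term-suc-≤ r (λ k → inv (P (N ∸ k)))) ⟩
    0ℚ + - w (suc s) * fractionSum N r
      ≡⟨ simplify (w (suc s)) (fractionSum N r) ⟩
    - (w (suc s) * fractionSum N r) ∎
    where
    N = suc r +ℕ suc s
    C : ℕ → ℚ
    C k = P (suc r ∸ k) * term (suc r) k * inv (P (N ∸ k))

    simplify : ∀ a f → 0ℚ + - a * f ≡ - (a * f)
    simplify = solve-∀ ℚ-ring

    split : ∀ {k} → k ≤ suc r →
            P (suc s) * (term (suc r) k * inv (P (N ∸ k))) ≡ term (suc r) k + - w (suc s) * C k
    split {k} k≤1+r =
      subst (λ l → P (suc s) * (t * inv (P l)) ≡ t + - w (suc s) * (P m * t * inv (P l)))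
            (sym (ℕ.+-∸-comm (suc s) k≤1+r)) (P-suc*fraction m s t)
      where
      t = term (suc r) k
      m = suc r ∸ k

  closedForm-rec : ∀ {N} s r → suc s ≤ N →
    P (suc s) * closedForm s (suc r) N ≡ - (w (suc s) * closedForm (suc s) r N)
  closedForm-rec {N} s r s<N = begin
    P (suc s) * (- 1ℚ * sgn r * w A * w B * inv Π₀)
      ≡⟨ regroup (P (suc s)) (sgn r) (w A) (w B) (inv Π₀) ⟩
    - (sgn r * (w A * w B) * (P (suc s) * inv Π₀))
      ≡⟨ cong₂ (λ u v → - (sgn r * u * v)) powers cancel ⟩
    - (sgn r * (w T * w M * w (suc s)) * inv Π₁)
      ≡⟨ regroup′ (sgn r) (w T) (w M) (w (suc s)) (inv Π₁) ⟩
    - (w (suc s) * closedForm (suc s) r N) ∎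
    where
    T = tri (suc r)
    A = suc r +ℕ T
    B = s *ℕ suc r
    M = suc s *ℕ r
    Π₀ = prodFromTo (suc s) N P
    Π₁ = prodFromTo (suc (suc s)) N P

    exponent : ∀ r s T → suc r +ℕ T +ℕ s *ℕ suc r ≡ T +ℕ suc s *ℕ r +ℕ suc s
    exponent = ℕ-solve-∀
    regroup : ∀ p σ a b i → p * (- 1ℚ * σ * a * b * i) ≡ - (σ * (a * b) * (p * i))
    regroup = solve-∀ ℚ-ring
    regroup′ : ∀ σ t m x i → - (σ * (t * m * x) * i) ≡ - (x * (σ * t * m * i))
    regroup′ = solve-∀ ℚ-ring

    powers : w A * w B ≡ w T * w M * w (suc s)
    powers = begin
      w A * w B               ≡⟨ sym (w-+ A B) ⟩
      w (A +ℕ B)              ≡⟨ cong w (exponent r s T) ⟩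
      w (T +ℕ M +ℕ suc s)     ≡⟨ w-+ (T +ℕ M) (suc s) ⟩
      w (T +ℕ M) * w (suc s)  ≡⟨ cong (_* w (suc s)) (w-+ T M) ⟩
      w T * w M * w (suc s)   ∎

    cancel : P (suc s) * inv Π₀ ≡ inv Π₁
    cancel = trans (cong (λ π → P (suc s) * inv π) (prodFromTo-cons P s<N)) (*-inv-cancelˡ (P-suc≢0 s))

  fractionSum≡closedForm : ∀ s r → fractionSum (r +ℕ suc s) r ≡ closedForm s r (r +ℕ suc s)
  fractionSum≡closedForm s zero = trans fraction (sym closed)
    where
    i = inv (P (suc s))
    unit : ∀ i → 0ℚ + 1ℚ * 1ℚ * 1ℚ * 1ℚ * i ≡ 1ℚ * 1ℚ * 1ℚ * i
    unit = solve-∀ ℚ-ring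
    fraction : fractionSum (suc s) 0 ≡ 1ℚ * 1ℚ * 1ℚ * i
    fraction = trans (cong (λ z → 0ℚ + 1ℚ * z * 1ℚ * 1ℚ * i) w-0) (unit i)
    closed : closedForm s 0 (suc s) ≡ 1ℚ * 1ℚ * 1ℚ * i
    closed = begin
      1ℚ * w 0 * w (s *ℕ 0) * inv (prodFromTo (suc s) (suc s) P)
        ≡⟨ cong₂ (λ e π → 1ℚ * w 0 * w e * inv π) (ℕ.*-zeroʳ s) (prodFromTo-singleton (suc s) P) ⟩
      1ℚ * w 0 * w 0 * i
        ≡⟨ cong (λ z → 1ℚ * z * z * i) w-0 ⟩
      1ℚ * 1ℚ * 1ℚ * i ∎
  fractionSum≡closedForm s (suc r) = *-cancelˡ-≢0 (P-suc≢0 s) (begin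
    P (suc s) * fractionSum N (suc r)        ≡⟨ fractionSum-rec s r ⟩
    - (w (suc s) * fractionSum N r)          ≡⟨ cong (λ z → - (w (suc s) * z)) induction ⟩
    - (w (suc s) * closedForm (suc s) r N)   ≡⟨ sym (closedForm-rec s r (ℕ.m≤n+m (suc s) (suc r))) ⟩
    P (suc s) * closedForm s (suc r) N       ∎)
    where
    N = suc r +ℕ suc s
    induction : fractionSum N r ≡ closedForm (suc s) r N
    induction = subst (λ n → fractionSum n r ≡ closedForm (suc s) r n) (ℕ.+-suc r (suc s))
                      (fractionSum≡closedForm (suc s) r)

  sum-identity : (t h n : ℕ) → t < h → h ≤ n →
    sumFromTo 0 (h ∸ t ∸ 1) (λ k →
        (sgn k * w ((k *ℕ (k ∸ 1)) / 2))
        ÷ℚ ((1ℚ - w (n ∸ t ∸ k)) * poch (h ∸ t ∸ k ∸ 1) * poch k))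
      ≡
    (sgn (h ∸ t ∸ 1) * w (((h ∸ t) *ℕ (h ∸ t ∸ 1)) / 2) * w ((n ∸ h) *ℕ (h ∸ t ∸ 1)))
      ÷ℚ prodFromTo ((n ∸ h) +ℕ 1) (n ∸ t) P
  sum-identity t h n t<h h≤n = begin
    sumFromTo 0 r (λ k → sgn k * w ((k *ℕ (k ∸ 1)) / 2) * inv (P (n ∸ t ∸ k) * poch (h ∸ t ∸ k ∸ 1) * poch k))
      ≡⟨ sum-cong r (λ {k} _ → summand k) ⟩
    fractionSum (n ∸ t) r
      ≡⟨ subst (λ N → fractionSum N r ≡ closedForm (n ∸ h) r N) r+1+[n∸h]≡n∸t
               (fractionSum≡closedForm (n ∸ h) r) ⟩
    closedForm (n ∸ h) r (n ∸ t)
      ≡⟨ cong₂ (λ e a → sgn r * w e * w ((n ∸ h) *ℕ r) * inv (prodFromTo a (n ∸ t) P))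
               tri≡ (ℕ.+-comm 1 (n ∸ h)) ⟩
    sgn r * w (((h ∸ t) *ℕ r) / 2) * w ((n ∸ h) *ℕ r) * inv (prodFromTo ((n ∸ h) +ℕ 1) (n ∸ t) P) ∎
    where
    r = h ∸ t ∸ 1

    h∸t≡1+r : h ∸ t ≡ suc r
    h∸t≡1+r = m<n⇒n∸m≡1+[n∸m∸1] t<h

    r+1+[n∸h]≡n∸t : r +ℕ suc (n ∸ h) ≡ n ∸ t
    r+1+[n∸h]≡n∸t = begin
      r +ℕ suc (n ∸ h)     ≡⟨ ℕ.+-suc r (n ∸ h) ⟩
      suc r +ℕ (n ∸ h)     ≡⟨ cong (_+ℕ (n ∸ h)) (sym h∸t≡1+r) ⟩
      (h ∸ t) +ℕ (n ∸ h)   ≡⟨ [n∸m]+[o∸n]≡o∸m (ℕ.<⇒≤ t<h) h≤n ⟩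
      n ∸ t                ∎

    tri≡ : tri (suc r) ≡ ((h ∸ t) *ℕ r) / 2
    tri≡ = trans (cong tri (sym h∸t≡1+r)) (sym (k*[k∸1]/2≡tri (h ∸ t)))

    rotate : ∀ c d a b → c * (d * a * b) ≡ c * a * b * d
    rotate = solve-∀ ℚ-ring

    summand : ∀ k → (sgn k * w ((k *ℕ (k ∸ 1)) / 2)) * inv (P (n ∸ t ∸ k) * poch (h ∸ t ∸ k ∸ 1) * poch k)
                    ≡ term r k * inv (P (n ∸ t ∸ k))
    summand k = begin
      sgn k * w ((k *ℕ (k ∸ 1)) / 2) * inv (D * poch (h ∸ t ∸ k ∸ 1) * poch k)
        ≡⟨ cong₂ (λ e j → sgn k * w e * inv (D * poch j * poch k))
                 (k*[k∸1]/2≡tri k) (∸-∸-comm (h ∸ t) k 1) ⟩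
      sgn k * w (tri k) * inv (D * poch (r ∸ k) * poch k)
        ≡⟨ cong (sgn k * w (tri k) *_) (trans (inv-* (D * poch (r ∸ k)) (poch k))
                                              (cong (_* inv (poch k)) (inv-* D (poch (r ∸ k))))) ⟩
      sgn k * w (tri k) * (inv D * inv (poch (r ∸ k)) * inv (poch k))
        ≡⟨ rotate (sgn k * w (tri k)) (inv D) (inv (poch (r ∸ k))) (inv (poch k)) ⟩
      term r k * inv D ∎
      where
      D = P (n ∸ t ∸ k)

ℕ→ℚ≡mkℚ : ∀ n → ℕ→ℚ n ≡ mkℚ (+ n) 0 (coprime-sym (1-coprimeTo n))
ℕ→ℚ≡mkℚ n = normalize-coprime (coprime-sym (1-coprimeTo n))

ℕ→ℚ-* : ∀ m n → ℕ→ℚ m * ℕ→ℚ n ≡ ℕ→ℚ (m *ℕ n)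
ℕ→ℚ-* m n =
  trans (cong₂ _*_ (ℕ→ℚ≡mkℚ m) (ℕ→ℚ≡mkℚ n)) (cong (Data.Rational._/ 1) (sym (ℤ.pos-* m n)))

ℕ→ℚ-^ : ∀ m n → ℕ→ℚ m ^ℚ n ≡ ℕ→ℚ (m ^ℕ n)
ℕ→ℚ-^ m zero    = refl
ℕ→ℚ-^ m (suc n) = trans (cong (ℕ→ℚ m *_) (ℕ→ℚ-^ m n)) (ℕ→ℚ-* m (m ^ℕ n))

ℕ→ℚ-injective : ∀ {m n} → ℕ→ℚ m ≡ ℕ→ℚ n → m ≡ n
ℕ→ℚ-injective {m} {n} eq =
  ℤ.+-injective (trans (cong ↥_ (sym (ℕ→ℚ≡mkℚ m))) (trans (cong ↥_ eq) (cong ↥_ (ℕ→ℚ≡mkℚ n))))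

-- Squaring removes the sign: ((-q)^(l+1))² = (q²)^(l+1) is the image of a natural number.
-ℕ→ℚ^suc≢1 : ∀ {q} l → q ≢ 1 → (- ℕ→ℚ q) ^ℚ suc l ≢ 1ℚ
-ℕ→ℚ^suc≢1 {q} l q≢1 y≡1 =
  q≢1 (ℕ.m*n≡1⇒m≡1 q q (ℕ.m*n≡1⇒m≡1 (q *ℕ q) _ (ℕ→ℚ-injective (begin
    ℕ→ℚ ((q *ℕ q) ^ℕ suc l)    ≡⟨ sym (ℕ→ℚ-^ (q *ℕ q) (suc l)) ⟩
    ℕ→ℚ (q *ℕ q) ^ℚ suc l      ≡⟨ cong (_^ℚ suc l) (sym (ℕ→ℚ-* q q)) ⟩
    (Q * Q) ^ℚ suc l           ≡⟨ cong (_^ℚ suc l) (neg-square Q) ⟩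
    (- Q * - Q) ^ℚ suc l       ≡⟨ ^ℚ-distribʳ-* (- Q) (- Q) (suc l) ⟩
    y * y                      ≡⟨ cong₂ _*_ y≡1 y≡1 ⟩
    1ℚ                         ∎))))
  where
  Q = ℕ→ℚ q
  y = (- Q) ^ℚ suc l
  neg-square : ∀ a → a * a ≡ - a * - a
  neg-square = solve-∀ ℚ-ring

negqInvPow-+ : ∀ q m n → negqInvPow q (m +ℕ n) ≡ negqInvPow q m * negqInvPow q n
negqInvPow-+ q m n = trans (cong inv (^ℚ-+ (- ℕ→ℚ q) m n)) (inv-* ((- ℕ→ℚ q) ^ℚ m) ((- ℕ→ℚ q) ^ℚ n))

negqInvPow-suc≢1 : ∀ {q} → q ≢ 1 → ∀ l → negqInvPow q (suc l) ≢ 1ℚ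
negqInvPow-suc≢1 q≢1 l w≡1 = -ℕ→ℚ^suc≢1 l q≢1 (trans (sym (inv-involutive _)) (cong inv w≡1))

prime-power≢1 : ∀ {p e} → Prime p → 1 ≤ e → p ^ℕ e ≢ 1
prime-power≢1 {p} {suc e} p-prime _ p^e≡1 = ¬prime[1] (subst Prime (ℕ.m*n≡1⇒m≡1 p (p ^ℕ e) p^e≡1) p-prime)

lemma9p7 : (p e q : ℕ) → Prime p → p % 2 ≡ 1 → 1 ≤ e → q ≡ p ^ℕ e →
    (t h n : ℕ) → t < h → h ≤ n →
    sumFromTo 0 (h ∸ t ∸ 1) (λ k →
        (sgn k * negqInvPow q ((k *ℕ (k ∸ 1)) / 2))
        ÷ℚ ((1ℚ - negqInvPow q (n ∸ t ∸ k))
            * prodFromTo 1 (h ∸ t ∸ k ∸ 1) (λ l → 1ℚ - negqInvPow q l)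
            * prodFromTo 1 k (λ l → 1ℚ - negqInvPow q l)))
      ≡
    (sgn (h ∸ t ∸ 1)
        * negqInvPow q (((h ∸ t) *ℕ (h ∸ t ∸ 1)) / 2)
        * negqInvPow q ((n ∸ h) *ℕ (h ∸ t ∸ 1)))
      ÷ℚ prodFromTo ((n ∸ h) +ℕ 1) (n ∸ t) (λ l → 1ℚ - negqInvPow q l)
lemma9p7 p e q p-prime _ 1≤e q≡p^e t h n t<h h≤n =
  sum-identity (negqInvPow q) refl (negqInvPow-+ q) (negqInvPow-suc≢1 q≢1) t h n t<h h≤n
  where
  q≢1 : q ≢ 1
  q≢1 = subst (_≢ 1) (sym q≡p^e) (prime-power≢1 p-prime 1≤e)
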